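{- Let $r \ge 6$ be an integer. Then \begin{align*} \max \{K(\underline{l});\ \underline{l} \in E_{r,1}\} &< F_{r+2} = \kappa_{r+1}, \\ \min \{K(\underline{l});\ \underline{l} \in E_{r,1}\} &= \kappa_{1,r-2}(2) = F_{r+1} + F_{r-1}, \\ \max \{K(\underline{l});\ \underline{l} \in U_r\} &= \kappa_{2,r-4}(3) = F_{r+1} + F_{r-1} - 2F_{r-4}, \\ \max \{K(\underline{l});\ \underline{l} \in V_r\} &= \kappa_{2,0,r-5}(2,2) = F_{r+1} + F_{r-1} - F_{r-7}. \end{align*} Consequently \[ \max \{K(\underline{l});\ \underline{l} \in E_{r-1,0} \cup E_{r,2}\} \le \min \{K(\underline{l});\ \underline{l} \in E_{r,1}\}, \] with strict inequality when $r \ne 7$.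
   Context: $F_n$ denotes the $n$th Fibonacci number ($F_0=0$, $F_1=1$, $F_n=F_{n-1}+F_{n-2}$ for all $n\in\mathbb{Z}$). The continuants $K_d(X_1,\dotsc,X_d)$ are defined by $K_0 = 1$, $K_1(X_1) = X_1$, and $K_d(X_1,\dotsc,X_d) = X_d K_{d-1}(X_1,\dotsc,X_{d-1}) + K_{d-2}(X_1,\dotsc,X_{d-2})$ for $d\ge 2$; write $K(\underline{l})$ for the continuant of a tuple $\underline{l}$. For $s,p_0,\dotsc,p_s\in\mathbb{Z}_{\ge 0}$, $w_{p_0,\dotsc,p_s}(X_1,\dotsc,X_s)$ is the tuple consisting of $p_0$ ones, then $X_1$, then $p_1$ ones, then $X_2$, ..., then $X_s$, then $p_s$ ones (for $s=0$, $w_{p_0}$ is the tuple of $p_0$ ones); and $\kappa_{p_0,\dotsc,p_s}(X_1,\dotsc,X_s) = K(w_{p_0,\dotsc,p_s}(X_1,\dotsc,X_s))$. For $r\in\mathbb{Z}$, $E_r$ is the set of all tuples $(l_1,\dotsc,l_d)$ with $d\in\mathbb{Z}_{\ge 1}$, $l_1,\dotsc,l_d\in\mathbb{Z}_{\ge 1}$, $l_1=l_d=1$ and $l_1+\dotsb+l_d = r+1$; with $h(l_1,\dotsc,l_d) = l_1+\dotsb+l_d-d$, set $E_{r,a} = \{\underline{l}\in E_r;\ h(\underline{l})=a\}$ for $a\in\mathbb{Z}_{\ge 0}$. Finally $U_r = \{w_{p_0,p_1}(3);\ p_0,p_1\in\mathbb{Z}_{\ge 1},\ p_0+p_1 = r-2\}$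 and $V_r = \{w_{p_0,p_1,p_2}(2,2);\ p_0,p_2\in\mathbb{Z}_{\ge 1},\ p_1\in\mathbb{Z}_{\ge 0},\ p_0+p_1+p_2 = r-3\}$. -}

module Defs where

open import Data.Nat as ℕ using (ℕ; zero; suc; _+_; _*_; _∸_; _≤_)
open import Data.Integer as ℤ using (ℤ; +_; -[1+_])
open import Data.List using (List; []; _∷_; _++_; replicate; length; head; last)
open import Data.Nat.ListAction using (sum)
open import Data.List.Relation.Unary.All using (All)
open import Data.Maybe using (just)
open import Data.Product using (Σ; ∃; ∃-syntax; _×_; _,_)
open import Relation.Binary.PropositionalEquality using (_≡_)

fibℕ : ℕ → ℕ
fibℕ zero = 0
fibℕ (suc zero) = 1
fibℕ (suc (suc n)) = fibℕ (suc n) + fibℕ n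

altSign : ℕ → ℤ
altSign zero = + 1
altSign (suc n) = ℤ.- altSign n

F : ℤ → ℤ
F (+ n) = + fibℕ n
F -[1+ n ] = altSign n ℤ.* (+ fibℕ (suc n))

-- Continuants.  K_0 = 1, K_1(X_1) = X_1,
-- K_d = X_d K_{d-1} + K_{d-2}; computed left to right with the pair
-- (K_{d-2}, K_{d-1}) as accumulator (K_{-1} := 0 makes K_1 = X_1 * 1 + 0).

Kaux : ℕ → ℕ → List ℕ → ℕ
Kaux a b [] = b
Kaux a b (x ∷ xs) = Kaux b (x * b + a) xs

K : List ℕ → ℕ
K = Kaux 0 1

-- w_{p_0,...,p_s}(X_1,...,X_s): given p_0 and the list of pairs
-- (X_1,p_1),...,(X_s,p_s): p_0 ones, X_1, p_1 ones, ..., X_s, p_s ones.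

ones : ℕ → List ℕ
ones n = replicate n 1

w : ℕ → List (ℕ × ℕ) → List ℕ
w p₀ [] = ones p₀
w p₀ ((x , p) ∷ rest) = ones p₀ ++ (x ∷ w p rest)

κ : ℕ → List (ℕ × ℕ) → ℕ
κ p₀ xs = K (w p₀ xs)

E : ℕ → List ℕ → Set
E r l = All (λ x → 1 ≤ x) l × head l ≡ just 1 × last l ≡ just 1 × sum l ≡ suc r
-- (l nonempty is implied by head l ≡ just 1)

h : List ℕ → ℕ
h l = sum l ∸ length l

Ea : ℕ → ℕ → List ℕ → Set
Ea r a l = E r l × h l ≡ a

U : ℕ → List ℕ → Set
U r l = ∃[ p₀ ] ∃[ p₁ ] (1 ≤ p₀ × 1 ≤ p₁ × p₀ + p₁ ≡ r ∸ 2 × l ≡ w p₀ ((3 , p₁) ∷ []))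

V : ℕ → List ℕ → Set
V r l = ∃[ p₀ ] ∃[ p₁ ] ∃[ p₂ ]
  (1 ≤ p₀ × 1 ≤ p₂ × p₀ + p₁ + p₂ ≡ r ∸ 3 × l ≡ w p₀ ((2 , p₁) ∷ (2 , p₂) ∷ []))

IsMax : {A : Set} → (A → Set) → (A → ℕ) → ℕ → Set
IsMax {A} P f v = (∃[ x ] (P x × f x ≡ v)) × (∀ (x : A) → P x → f x ≤ v)

IsMin : {A : Set} → (A → Set) → (A → ℕ) → ℕ → Set
IsMin {A} P f v = (∃[ x ] (P x × f x ≡ v)) × (∀ (x : A) → P x → v ≤ f x)

{-# OPTIONS --safe #-}
module Submission where

-- A continuant is affine in each entry, so K(1^p (1+y) 1^q) = F_{p+q+2} + y F_{p+1} F_{q+1}.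
-- For p = a + 1 and q = c + 1 the product F_{a+2} F_{c+2} is pinned down by the identities
-- F_{a+2} F_{c+2} = F_{a+c+2} + F_a F_c  and  F_{a+2} F_{c+2} + F_{a-1} F_{c-1} = 2 F_{a+c+1}
-- (with F_{-1} = 1): on E_{r,1} and on U_r the continuant is smallest at a = 0 and largest at
-- a = 1, where F_{a-1} = 0. On V_r, moving the ones between the two 2s to the right end does not
-- decrease K, and K(1^{a+1} 2 2 1^{c+1}) + 2 F_{a-1} F_{c-1} = F_{a+c+6} + 4 F_{a+c+1}, so again
-- a = 1 is optimal. Since E_{r,2} = U_r ∪ V_r and E_{r-1,0} = {1^r}, the consequence compares
-- these maxima with min E_{r,1} = F_{r+1} + F_{r-1}: the gaps are F_{r-1}, 2 F_{r-4} and F_{r-7},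
-- and only the last one vanishes, at r = 7.

open import Defs
open import Data.Nat using (ℕ; zero; suc; _+_; _*_; _∸_; _≤_; _<_; z≤n; s≤s)
open import Data.Nat.Properties
open import Data.Nat.Tactic.RingSolver using (solve-∀)
open import Data.Integer as ℤ using (ℤ; +_; _⊖_)
open import Data.Integer.Properties using (pos-*; m-n≡m⊖n; ⊖-≥)
open import Data.List using (List; []; _∷_; _++_; length; head; last)
open import Data.List.Properties using (++-assoc; length-++; length-replicate)
open import Data.Nat.ListAction using (sum)
open import Data.Nat.ListAction.Properties using (sum-++)
open import Data.List.Relation.Unary.All using (All; []; _∷_)
open import Data.List.Relation.Unary.All.Properties using (++⁺)
open import Data.Maybe using (just)
open import Data.Product using (∃-syntax; _×_; _,_; proj₂)
open import Data.Sum using (_⊎_; inj₁; inj₂)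
open import Function using (_∘_)
open import Relation.Nullary using (contradiction)
open import Relation.Binary.PropositionalEquality

-- F_{n-1}, with the convention F_{-1} = 1.
fib⁻ : ℕ → ℕ
fib⁻ zero    = 1
fib⁻ (suc n) = fibℕ n

fib⁻+fib : ∀ n → fib⁻ n + fibℕ n ≡ fibℕ (suc n)
fib⁻+fib zero    = refl
fib⁻+fib (suc n) = +-comm (fibℕ n) (fibℕ (suc n))

fib-mono : ∀ n → fibℕ n ≤ fibℕ (suc n)
fib-mono n = subst (fibℕ n ≤_) (fib⁻+fib n) (m≤n+m (fibℕ n) (fib⁻ n))

fib-pos : ∀ n → 0 < fibℕ (suc n)
fib-pos zero    = s≤s z≤n
fib-pos (suc n) = ≤-trans (fib-pos n) (m≤m+n _ _)

fib-strict : ∀ n → fibℕ (2 + n) < fibℕ (3 + n)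
fib-strict n = subst (_≤ fibℕ (3 + n)) (+-comm (fibℕ (2 + n)) 1)
                     (+-monoʳ-≤ (fibℕ (2 + n)) (fib-pos n))

fib⁻-pos : ∀ {n} → n ≢ 1 → 0 < fib⁻ n
fib⁻-pos {zero}        _   = s≤s z≤n
fib⁻-pos {suc zero}    n≢1 = contradiction refl n≢1
fib⁻-pos {suc (suc n)} _   = fib-pos n

fib-2+≤2*fib-1+ : ∀ n → fibℕ (2 + n) ≤ 2 * fibℕ (1 + n)
fib-2+≤2*fib-1+ n = ≤-trans (+-monoʳ-≤ (fibℕ (1 + n)) (fib-mono n))
                            (≤-reflexive (cong (_+_ (fibℕ (1 + n))) (sym (+-identityʳ (fibℕ (1 + n))))))

2*fib-2+≤fib-4+ : ∀ n → 2 * fibℕ (2 + n) ≤ fibℕ (4 + n)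
2*fib-2+≤fib-4+ n = ≤-trans (≤-reflexive (cong (_+_ (fibℕ (2 + n))) (+-identityʳ (fibℕ (2 + n)))))
                            (+-monoˡ-≤ (fibℕ (2 + n)) (fib-mono (2 + n)))

fib-+ : ∀ m n → fibℕ (suc (m + n)) ≡ fibℕ (suc m) * fibℕ (suc n) + fibℕ m * fibℕ n
fib-+ zero    n = sym (trans (+-identityʳ _) (*-identityˡ _))
fib-+ (suc m) n = begin
  fibℕ (suc (suc m + n))                               ≡⟨ cong (fibℕ ∘ suc) (sym (+-suc m n)) ⟩
  fibℕ (suc (m + suc n))                               ≡⟨ fib-+ m (suc n) ⟩
  fibℕ (suc m) * fibℕ (2 + n) + fibℕ m * fibℕ (suc n)  ≡⟨ regroup (fibℕ (suc m)) (fibℕ m) (fibℕ (suc n)) (fibℕ n) ⟩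
  fibℕ (2 + m) * fibℕ (suc n) + fibℕ (suc m) * fibℕ n  ∎
  where
  open ≡-Reasoning
  regroup : ∀ a b c d → a * (c + d) + b * c ≡ (a + b) * c + a * d
  regroup = solve-∀

fib⁻-+ : ∀ m n → fib⁻ (m + n) ≡ fibℕ m * fibℕ n + fib⁻ m * fib⁻ n
fib⁻-+ zero    n       = sym (+-identityʳ (fib⁻ n))
fib⁻-+ (suc m) zero    = trans (cong fibℕ (+-identityʳ m))
                           (sym (cong₂ _+_ (*-zeroʳ (fibℕ (suc m))) (*-identityʳ (fibℕ m))))
fib⁻-+ (suc m) (suc n) = trans (cong fibℕ (+-suc m n)) (fib-+ m n)

fib-2+*fib-2+ : ∀ m n → fibℕ (2 + m) * fibℕ (2 + n) ≡ fibℕ (2 + (m + n)) + fibℕ m * fibℕ n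
fib-2+*fib-2+ m n = begin
  fibℕ (2 + m) * fibℕ (2 + n)                                             ≡⟨ regroup (fibℕ (suc m)) (fibℕ m) (fibℕ (suc n)) (fibℕ n) ⟩
  (fibℕ (2 + m) * fibℕ (suc n) + fibℕ (suc m) * fibℕ n) + fibℕ m * fibℕ n ≡⟨ cong (_+ fibℕ m * fibℕ n) (sym (fib-+ (suc m) n)) ⟩
  fibℕ (2 + (m + n)) + fibℕ m * fibℕ n                                    ∎
  where
  open ≡-Reasoning
  regroup : ∀ a b c d → (a + b) * (c + d) ≡ ((a + b) * c + a * d) + b * d
  regroup = solve-∀

fib-2+*fib-2+-vajda : ∀ m n → fibℕ (2 + m) * fibℕ (2 + n) + fib⁻ m * fib⁻ n ≡ 2 * fibℕ (1 + (m + n))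
fib-2+*fib-2+-vajda m n = begin
  fibℕ (2 + m) * fibℕ (2 + n) + fib⁻ m * fib⁻ n            ≡⟨ cong (_+ fib⁻ m * fib⁻ n) (fib-2+*fib-2+ m n) ⟩
  fibℕ (2 + s) + fibℕ m * fibℕ n + fib⁻ m * fib⁻ n         ≡⟨ +-assoc (fibℕ (2 + s)) _ _ ⟩
  fibℕ (2 + s) + (fibℕ m * fibℕ n + fib⁻ m * fib⁻ n)       ≡⟨ cong (_+_ (fibℕ (2 + s))) (sym (fib⁻-+ m n)) ⟩
  fibℕ (1 + s) + fibℕ s + fib⁻ s                           ≡⟨ +-assoc (fibℕ (1 + s)) _ _ ⟩
  fibℕ (1 + s) + (fibℕ s + fib⁻ s)                         ≡⟨ cong (_+_ (fibℕ (1 + s))) (trans (+-comm (fibℕ s) (fib⁻ s)) (fib⁻+fib s)) ⟩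
  fibℕ (1 + s) + fibℕ (1 + s)                              ≡⟨ cong (_+_ (fibℕ (1 + s))) (sym (+-identityʳ _)) ⟩
  2 * fibℕ (1 + s)                                         ∎
  where
  open ≡-Reasoning
  s = m + n

fib-5+ : ∀ t → fibℕ (5 + t) ≡ 2 * (2 * fibℕ (2 + t)) + fib⁻ t
fib-5+ t = sym (begin
  2 * (2 * z) + fib⁻ t    ≡⟨ regroup z (fib⁻ t) ⟩
  3 * z + (z + fib⁻ t)    ≡⟨ cong (_+_ (3 * z)) (sym q+q) ⟩
  3 * z + (q + q)         ≡⟨ regroup′ z q ⟩
  ((z + q) + z) + (z + q) ∎)
  where
  open ≡-Reasoning
  z = fibℕ (2 + t)
  q = fibℕ (1 + t)
  regroup : ∀ z g → 2 * (2 * z) + g ≡ 3 * z + (z + g)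
  regroup = solve-∀
  regroup′ : ∀ z q → 3 * z + (q + q) ≡ ((z + q) + z) + (z + q)
  regroup′ = solve-∀
  regroup″ : ∀ q g b → q + (g + b) ≡ (q + b) + g
  regroup″ = solve-∀
  q+q : q + q ≡ z + fib⁻ t
  q+q = trans (cong (_+_ q) (sym (fib⁻+fib t))) (regroup″ q (fib⁻ t) (fibℕ t))

K⁻ : List ℕ → ℕ
K⁻ []       = 0
K⁻ (_ ∷ xs) = K xs

Kaux-linear : ∀ a b xs → Kaux a b xs ≡ a * K⁻ xs + b * K xs
Kaux-linear a b []       = sym (cong₂ _+_ (*-zeroʳ a) (*-identityʳ b))
Kaux-linear a b (x ∷ xs) = begin
  Kaux b (x * b + a) xs                           ≡⟨ Kaux-linear b (x * b + a) xs ⟩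
  b * K⁻ xs + (x * b + a) * K xs                  ≡⟨ regroup a b x (K⁻ xs) (K xs) ⟩
  a * K xs + b * (1 * K⁻ xs + (x * 1 + 0) * K xs) ≡⟨ cong (λ k → a * K xs + b * k) (sym (Kaux-linear 1 (x * 1 + 0) xs)) ⟩
  a * K xs + b * K (x ∷ xs)                       ∎
  where
  open ≡-Reasoning
  regroup : ∀ a b x p q → b * p + (x * b + a) * q ≡ a * q + b * (1 * p + (x * 1 + 0) * q)
  regroup = solve-∀

K-∷ : ∀ x xs → K (x ∷ xs) ≡ x * K xs + K⁻ xs
K-∷ x xs = trans (Kaux-linear 1 (x * 1 + 0) xs) (regroup x (K⁻ xs) (K xs))
  where
  regroup : ∀ x p q → 1 * p + (x * 1 + 0) * q ≡ x * q + p
  regroup = solve-∀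

Kaux-++-+ : ∀ a b xs x y ys →
  Kaux a b (xs ++ (x + y) ∷ ys) ≡ Kaux a b (xs ++ x ∷ ys) + y * (Kaux a b xs * K ys)
Kaux-++-+ a b []       x y ys = begin
  Kaux b ((x + y) * b + a) ys                        ≡⟨ Kaux-linear b _ ys ⟩
  b * K⁻ ys + ((x + y) * b + a) * K ys               ≡⟨ regroup a b x y (K⁻ ys) (K ys) ⟩
  (b * K⁻ ys + (x * b + a) * K ys) + y * (b * K ys) ≡⟨ cong (_+ y * (b * K ys)) (sym (Kaux-linear b _ ys)) ⟩
  Kaux b (x * b + a) ys + y * (b * K ys)             ∎
  where
  open ≡-Reasoning
  regroup : ∀ a b x y p q → b * p + ((x + y) * b + a) * q ≡ (b * p + (x * b + a) * q) + y * (b * q)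
  regroup = solve-∀
Kaux-++-+ a b (z ∷ zs) x y ys = Kaux-++-+ b (z * b + a) zs x y ys

K-ones  : ∀ n → K (ones n) ≡ fibℕ (suc n)
K⁻-ones : ∀ n → K⁻ (ones n) ≡ fibℕ n
K⁻-ones zero    = refl
K⁻-ones (suc n) = K-ones n
K-ones zero    = refl
K-ones (suc n) = begin
  K (1 ∷ ones n)               ≡⟨ K-∷ 1 (ones n) ⟩
  1 * K (ones n) + K⁻ (ones n) ≡⟨ cong₂ _+_ (trans (*-identityˡ _) (K-ones n)) (K⁻-ones n) ⟩
  fibℕ (suc n) + fibℕ n        ∎
  where open ≡-Reasoning

ones-++ : ∀ m n → ones m ++ ones n ≡ ones (m + n)
ones-++ zero    n = refl
ones-++ (suc m) n = cong (1 ∷_) (ones-++ m n)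

K-w₁ : ∀ p y q → K (w p ((suc y , q) ∷ [])) ≡ fibℕ (suc (p + suc q)) + y * (fibℕ (suc p) * fibℕ (suc q))
K-w₁ p y q = begin
  K (ones p ++ (1 + y) ∷ ones q)                             ≡⟨ Kaux-++-+ 0 1 (ones p) 1 y (ones q) ⟩
  K (ones p ++ ones (suc q)) + y * (K (ones p) * K (ones q)) ≡⟨ cong₂ (λ u v → u + y * v)
                                                                  (trans (cong K (ones-++ p (suc q))) (K-ones (p + suc q)))
                                                                  (cong₂ _*_ (K-ones p) (K-ones q)) ⟩
  fibℕ (suc (p + suc q)) + y * (fibℕ (suc p) * fibℕ (suc q)) ∎
  where open ≡-Reasoning

K-w₂ : ∀ p x b y q → K (w p ((x , b) ∷ (suc y , q) ∷ []))
                    ≡ K (w p ((x , b + suc q) ∷ [])) + y * (K (w p ((x , b) ∷ [])) * fibℕ (suc q))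
K-w₂ p x b y q = begin
  K (ones p ++ x ∷ (ones b ++ (1 + y) ∷ ones q))                 ≡⟨ cong K (sym (++-assoc (ones p) (x ∷ ones b) _)) ⟩
  K (xs ++ (1 + y) ∷ ones q)                                     ≡⟨ Kaux-++-+ 0 1 xs 1 y (ones q) ⟩
  K (xs ++ ones (suc q)) + y * (K xs * K (ones q))               ≡⟨ cong₂ (λ u v → K u + y * (K xs * v)) merge (K-ones q) ⟩
  K (ones p ++ x ∷ ones (b + suc q)) + y * (K xs * fibℕ (suc q)) ∎
  where
  open ≡-Reasoning
  xs = ones p ++ x ∷ ones b
  merge : xs ++ ones (suc q) ≡ ones p ++ x ∷ ones (b + suc q)
  merge = trans (++-assoc (ones p) (x ∷ ones b) _) (cong (λ zs → ones p ++ x ∷ zs) (ones-++ b (suc q)))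

w₁-index : ∀ a c → suc (suc a + suc (suc c)) ≡ 4 + (a + c)
w₁-index = solve-∀

K-w₁-vajda : ∀ a y c → K (w (suc a) ((suc y , suc c) ∷ [])) + y * (fib⁻ a * fib⁻ c)
                       ≡ fibℕ (4 + (a + c)) + y * (2 * fibℕ (1 + (a + c)))
K-w₁-vajda a y c = begin
  K (w (suc a) ((suc y , suc c) ∷ [])) + y * G      ≡⟨ cong (_+ y * G) (K-w₁ (suc a) y (suc c)) ⟩
  fibℕ I + y * P + y * G                            ≡⟨ regroup (fibℕ I) y P G ⟩
  fibℕ I + y * (P + G)                              ≡⟨ cong₂ (λ i v → fibℕ i + y * v) (w₁-index a c) (fib-2+*fib-2+-vajda a c) ⟩
  fibℕ (4 + (a + c)) + y * (2 * fibℕ (1 + (a + c))) ∎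
  where
  open ≡-Reasoning
  I = suc (suc a + suc (suc c))
  P = fibℕ (2 + a) * fibℕ (2 + c)
  G = fib⁻ a * fib⁻ c
  regroup : ∀ i y p g → i + y * p + y * g ≡ i + y * (p + g)
  regroup = solve-∀

K-w₁-≥ : ∀ a y c → fibℕ (4 + (a + c)) + y * fibℕ (2 + (a + c)) ≤ K (w (suc a) ((suc y , suc c) ∷ []))
K-w₁-≥ a y c = begin
  fibℕ (4 + (a + c)) + y * fibℕ (2 + (a + c))                          ≤⟨ +-monoʳ-≤ (fibℕ (4 + (a + c))) (*-monoʳ-≤ y (m≤m+n _ _)) ⟩
  fibℕ (4 + (a + c)) + y * (fibℕ (2 + (a + c)) + fibℕ a * fibℕ c)      ≡⟨ cong₂ (λ i v → fibℕ i + y * v)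
                                                                            (sym (w₁-index a c)) (sym (fib-2+*fib-2+ a c)) ⟩
  fibℕ (suc (suc a + suc (suc c))) + y * (fibℕ (2 + a) * fibℕ (2 + c)) ≡⟨ sym (K-w₁ (suc a) y (suc c)) ⟩
  K (w (suc a) ((suc y , suc c) ∷ []))                                  ∎
  where open ≤-Reasoning

-- U r is W₁ 3 (r ∸ 2) by definition.
W₁ : ℕ → ℕ → List ℕ → Set
W₁ x s l = ∃[ p ] ∃[ q ] (1 ≤ p × 1 ≤ q × p + q ≡ s × l ≡ w p ((x , q) ∷ []))

suc+suc-injective : ∀ a c {s} → suc a + suc c ≡ 2 + s → a + c ≡ s
suc+suc-injective a c eq = suc-injective (trans (sym (+-suc a c)) (suc-injective eq))

W₁-≤ : ∀ y s {l} → W₁ (suc y) (2 + s) l → K l ≤ fibℕ (4 + s) + y * (2 * fibℕ (1 + s))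
W₁-≤ y s (suc a , suc c , s≤s z≤n , s≤s z≤n , eq , refl) =
  subst (λ n → K (w (suc a) ((suc y , suc c) ∷ [])) ≤ fibℕ (4 + n) + y * (2 * fibℕ (1 + n)))
        (suc+suc-injective a c eq)
        (m+n≤o⇒m≤o (K (w (suc a) ((suc y , suc c) ∷ []))) (≤-reflexive (K-w₁-vajda a y c)))

W₁-≥ : ∀ y s {l} → W₁ (suc y) (2 + s) l → fibℕ (4 + s) + y * fibℕ (2 + s) ≤ K l
W₁-≥ y s (suc a , suc c , s≤s z≤n , s≤s z≤n , eq , refl) =
  subst (λ n → fibℕ (4 + n) + y * fibℕ (2 + n) ≤ K (w (suc a) ((suc y , suc c) ∷ [])))
        (suc+suc-injective a c eq) (K-w₁-≥ a y c)

K-w₁-2 : ∀ a b → K (w (suc a) ((2 , b) ∷ [])) ≡ fibℕ (4 + a) * fibℕ (suc b) + fibℕ (2 + a) * fibℕ b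
K-w₁-2 a b = begin
  K (w (suc a) ((2 , b) ∷ []))                                   ≡⟨ K-w₁ (suc a) 1 b ⟩
  fibℕ (suc (suc a + suc b)) + 1 * P                             ≡⟨ cong (λ i → fibℕ (2 + i) + 1 * P) (+-suc a b) ⟩
  fibℕ (suc (2 + a + b)) + 1 * P                                 ≡⟨ cong (_+ 1 * P) (fib-+ (2 + a) b) ⟩
  fibℕ (3 + a) * fibℕ (suc b) + fibℕ (2 + a) * fibℕ b + 1 * P    ≡⟨ regroup (fibℕ (3 + a)) (fibℕ (2 + a)) (fibℕ (suc b)) (fibℕ b) ⟩
  fibℕ (4 + a) * fibℕ (suc b) + fibℕ (2 + a) * fibℕ b            ∎
  where
  open ≡-Reasoning
  P = fibℕ (2 + a) * fibℕ (suc b)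
  regroup : ∀ p q x y → p * x + q * y + 1 * (q * x) ≡ (p + q) * x + q * y
  regroup = solve-∀

K-w₁-2-0 : ∀ a → K (w (suc a) ((2 , 0) ∷ [])) ≡ fibℕ (4 + a)
K-w₁-2-0 a = trans (K-w₁-2 a 0)
  (trans (cong₂ _+_ (*-identityʳ (fibℕ (4 + a))) (*-zeroʳ (fibℕ (2 + a)))) (+-identityʳ (fibℕ (4 + a))))

-- Since F_{a+4} ≥ 2 F_{a+2} and F_{c+2} ≤ 2 F_{c+1}.
K-w₁-2-*-fib : ∀ a b c → K (w (suc a) ((2 , b) ∷ [])) * fibℕ (2 + c) ≤ fibℕ (4 + a) * fibℕ (2 + (b + c))
K-w₁-2-*-fib a b c = begin
  K (w (suc a) ((2 , b) ∷ [])) * fibℕ (2 + c)               ≡⟨ cong (_* fibℕ (2 + c)) (K-w₁-2 a b) ⟩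
  (A * fibℕ (suc b) + B * fibℕ b) * fibℕ (2 + c)            ≡⟨ regroup A B (fibℕ (suc b)) (fibℕ b) (fibℕ (2 + c)) ⟩
  A * (fibℕ (suc b) * fibℕ (2 + c)) + fibℕ b * (B * fibℕ (2 + c))
                                                            ≤⟨ +-monoʳ-≤ (A * (fibℕ (suc b) * fibℕ (2 + c))) (*-monoʳ-≤ (fibℕ b) B≤A) ⟩
  A * (fibℕ (suc b) * fibℕ (2 + c)) + fibℕ b * (A * fibℕ (suc c))
                                                            ≡⟨ regroup′ A (fibℕ (suc b)) (fibℕ b) (fibℕ (2 + c)) (fibℕ (suc c)) ⟩
  A * (fibℕ (suc b) * fibℕ (2 + c) + fibℕ b * fibℕ (suc c)) ≡⟨ cong (A *_) (sym (fib-+ b (suc c))) ⟩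
  A * fibℕ (suc (b + suc c))                                ≡⟨ cong (λ i → A * fibℕ (suc i)) (+-suc b c) ⟩
  A * fibℕ (2 + (b + c))                                    ∎
  where
  open ≤-Reasoning
  A = fibℕ (4 + a)
  B = fibℕ (2 + a)
  B≤A : B * fibℕ (2 + c) ≤ A * fibℕ (suc c)
  B≤A = begin
    B * fibℕ (2 + c)       ≤⟨ *-monoʳ-≤ B (fib-2+≤2*fib-1+ c) ⟩
    B * (2 * fibℕ (1 + c)) ≡⟨ trans (sym (*-assoc B 2 (fibℕ (1 + c)))) (cong (_* fibℕ (1 + c)) (*-comm B 2)) ⟩
    2 * B * fibℕ (1 + c)   ≤⟨ *-monoˡ-≤ (fibℕ (1 + c)) (2*fib-2+≤fib-4+ a) ⟩
    A * fibℕ (1 + c)       ∎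
  regroup : ∀ a b x y z → (a * x + b * y) * z ≡ a * (x * z) + y * (b * z)
  regroup = solve-∀
  regroup′ : ∀ a x y z u → a * (x * z) + y * (a * u) ≡ a * (x * z + y * u)
  regroup′ = solve-∀

K-w₂-2-b-2≤K-w₂-2-0-2 : ∀ a b c → K (w (suc a) ((2 , b) ∷ (2 , suc c) ∷ []))
                                 ≤ K (w (suc a) ((2 , 0) ∷ (2 , suc (b + c)) ∷ []))
K-w₂-2-b-2≤K-w₂-2-0-2 a b c = begin
  K (w (suc a) ((2 , b) ∷ (2 , suc c) ∷ []))
    ≡⟨ K-w₂ (suc a) 2 b 1 (suc c) ⟩
  K (w (suc a) ((2 , b + suc (suc c)) ∷ [])) + 1 * (K (w (suc a) ((2 , b) ∷ [])) * fibℕ (2 + c))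
    ≤⟨ +-mono-≤ (≤-reflexive (cong (λ q → K (w (suc a) ((2 , q) ∷ []))) (trans (+-suc b (suc c)) (cong suc (+-suc b c)))))
                (*-monoʳ-≤ 1 (K-w₁-2-*-fib a b c)) ⟩
  K (w (suc a) ((2 , 2 + (b + c)) ∷ [])) + 1 * (fibℕ (4 + a) * fibℕ (2 + (b + c)))
    ≡⟨ cong (λ k → K (w (suc a) ((2 , 2 + (b + c)) ∷ [])) + 1 * (k * fibℕ (2 + (b + c)))) (sym (K-w₁-2-0 a)) ⟩
  K (w (suc a) ((2 , 2 + (b + c)) ∷ [])) + 1 * (K (w (suc a) ((2 , 0) ∷ [])) * fibℕ (2 + (b + c)))
    ≡⟨ sym (K-w₂ (suc a) 2 0 1 (suc (b + c))) ⟩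
  K (w (suc a) ((2 , 0) ∷ (2 , suc (b + c)) ∷ [])) ∎
  where open ≤-Reasoning

K-w₂-2-0-2-vajda : ∀ a c → K (w (suc a) ((2 , 0) ∷ (2 , suc c) ∷ [])) + 2 * (fib⁻ a * fib⁻ c)
                           ≡ fibℕ (6 + (a + c)) + 2 * (2 * fibℕ (1 + (a + c)))
K-w₂-2-0-2-vajda a c = begin
  K (w (suc a) ((2 , 0) ∷ (2 , suc c) ∷ [])) + 2 * G
    ≡⟨ cong (_+ 2 * G) (K-w₂ (suc a) 2 0 1 (suc c)) ⟩
  K (w (suc a) ((2 , suc (suc c)) ∷ [])) + 1 * (K (w (suc a) ((2 , 0) ∷ [])) * C₂) + 2 * G
    ≡⟨ cong₂ (λ u v → u + 1 * (v * C₂) + 2 * G) (K-w₁ (suc a) 1 (suc (suc c))) (K-w₁-2-0 a) ⟩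
  fibℕ I + 1 * (A₂ * fibℕ (3 + c)) + 1 * (fibℕ (4 + a) * C₂) + 2 * G
    ≡⟨ regroup (fibℕ I) (fibℕ (3 + a)) A₂ C₂ (fibℕ (1 + c)) G ⟩
  fibℕ I + (fibℕ (3 + a) * C₂ + A₂ * fibℕ (1 + c)) + 2 * (A₂ * C₂ + G)
    ≡⟨ cong₂ (λ i k → fibℕ i + k + 2 * (A₂ * C₂ + G)) (index a c)
             (trans (sym (fib-+ (2 + a) (suc c))) (cong (fibℕ ∘ _+_ 3) (+-suc a c))) ⟩
  fibℕ (5 + (a + c)) + fibℕ (4 + (a + c)) + 2 * (A₂ * C₂ + G)
    ≡⟨ cong (λ k → fibℕ (6 + (a + c)) + 2 * k) (fib-2+*fib-2+-vajda a c) ⟩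
  fibℕ (6 + (a + c)) + 2 * (2 * fibℕ (1 + (a + c))) ∎
  where
  open ≡-Reasoning
  I  = suc (suc a + suc (suc (suc c)))
  A₂ = fibℕ (2 + a)
  C₂ = fibℕ (2 + c)
  G  = fib⁻ a * fib⁻ c
  index : ∀ a c → suc (suc a + suc (suc (suc c))) ≡ 5 + (a + c)
  index = solve-∀
  regroup : ∀ i p q x y g → i + 1 * (q * (x + y)) + 1 * ((p + q) * x) + 2 * g ≡ i + (p * x + q * y) + 2 * (q * x + g)
  regroup = solve-∀

V-≤ : ∀ s {l} → V (5 + s) l → K l ≤ fibℕ (6 + s) + 2 * (2 * fibℕ (1 + s))
V-≤ s (suc a , b , suc c , s≤s z≤n , s≤s z≤n , eq , refl) =
  subst (λ n → K (w (suc a) ((2 , b) ∷ (2 , suc c) ∷ [])) ≤ fibℕ (6 + n) + 2 * (2 * fibℕ (1 + n)))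
        (suc-injective (suc-injective (trans (regroup a b c) eq)))
        (≤-trans (K-w₂-2-b-2≤K-w₂-2-0-2 a b c)
                 (m+n≤o⇒m≤o (K (w (suc a) ((2 , 0) ∷ (2 , suc (b + c)) ∷ []))) (≤-reflexive (K-w₂-2-0-2-vajda a (b + c)))))
  where
  regroup : ∀ a b c → 2 + (a + (b + c)) ≡ suc a + b + suc c
  regroup = solve-∀

sum-ones : ∀ n → sum (ones n) ≡ n
sum-ones zero    = refl
sum-ones (suc n) = cong suc (sum-ones n)

sum-w₁ : ∀ p x q → sum (w p ((x , q) ∷ [])) ≡ p + (x + q)
sum-w₁ p x q = trans (sum-++ (ones p) (x ∷ ones q)) (cong₂ (λ m n → m + (x + n)) (sum-ones p) (sum-ones q))

sum-w₁-2 : ∀ p q → sum (w p ((2 , q) ∷ [])) ≡ 2 + (p + q)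
sum-w₁-2 p q = trans (sum-w₁ p 2 q) (regroup p q)
  where
  regroup : ∀ p q → p + (2 + q) ≡ 2 + (p + q)
  regroup = solve-∀

sum-w₂ : ∀ p x b y q → sum (w p ((x , b) ∷ (y , q) ∷ [])) ≡ p + (x + (b + (y + q)))
sum-w₂ p x b y q = trans (sum-++ (ones p) (x ∷ w b ((y , q) ∷ [])))
                         (cong₂ (λ m n → m + (x + n)) (sum-ones p) (sum-w₁ b y q))

length-w₁ : ∀ p x q → length (w p ((x , q) ∷ [])) ≡ p + suc q
length-w₁ p x q = trans (length-++ (ones p)) (cong₂ (λ m n → m + suc n) (length-replicate p) (length-replicate q))

All-ones : ∀ n → All (1 ≤_) (ones n)
All-ones zero    = []
All-ones (suc n) = s≤s z≤n ∷ All-ones n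

last-++ : ∀ (xs : List ℕ) y ys → last (xs ++ y ∷ ys) ≡ last (y ∷ ys)
last-++ []            y ys = refl
last-++ (x ∷ [])      y ys = refl
last-++ (x ∷ x′ ∷ xs) y ys = last-++ (x′ ∷ xs) y ys

last-ones : ∀ n → last (ones (suc n)) ≡ just 1
last-ones zero    = refl
last-ones (suc n) = last-ones n

length≤sum : ∀ {xs} → All (1 ≤_) xs → length xs ≤ sum xs
length≤sum []             = z≤n
length≤sum (s≤s z≤n ∷ ps) = s≤s (≤-trans (length≤sum ps) (m≤n+m _ _))

h-∷ : ∀ y {xs} → All (1 ≤_) xs → h (suc y ∷ xs) ≡ y + h xs
h-∷ y ps = +-∸-assoc y (length≤sum ps)

h-w₁ : ∀ p x q → h (w p ((suc x , q) ∷ [])) ≡ x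
h-w₁ p x q = begin
  sum (w p ((suc x , q) ∷ [])) ∸ length (w p ((suc x , q) ∷ [])) ≡⟨ cong₂ _∸_ (sum-w₁ p (suc x) q) (length-w₁ p (suc x) q) ⟩
  (p + (suc x + q)) ∸ (p + suc q)                                  ≡⟨ [m+n]∸[m+o]≡n∸o p (suc x + q) (suc q) ⟩
  (x + q) ∸ q                                                      ≡⟨ m+n∸n≡m x q ⟩
  x                                                                ∎
  where open ≡-Reasoning

h≡0⇒ones : ∀ {l} → All (1 ≤_) l → h l ≡ 0 → l ≡ ones (length l)
h≡0⇒ones []                                   _ = refl
h≡0⇒ones {suc zero ∷ xs}    (s≤s z≤n ∷ ps) e = cong (1 ∷_) (h≡0⇒ones ps (trans (sym (h-∷ 0 ps)) e))
h≡0⇒ones {suc (suc y) ∷ xs} (s≤s z≤n ∷ ps) e with () ← trans (sym (h-∷ (suc y) ps)) e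

h≡1⇒w : ∀ {l} → All (1 ≤_) l → h l ≡ 1 → ∃[ p ] ∃[ q ] l ≡ w p ((2 , q) ∷ [])
h≡1⇒w {suc zero ∷ xs} (s≤s z≤n ∷ ps) e with h≡1⇒w ps (trans (sym (h-∷ 0 ps)) e)
... | p , q , refl = suc p , q , refl
h≡1⇒w {suc (suc zero) ∷ xs} (s≤s z≤n ∷ ps) e =
  0 , length xs , cong (2 ∷_) (h≡0⇒ones ps (suc-injective (trans (sym (h-∷ 1 ps)) e)))
h≡1⇒w {suc (suc (suc y)) ∷ xs} (s≤s z≤n ∷ ps) e with () ← trans (sym (h-∷ (suc (suc y)) ps)) e

h≡2⇒w : ∀ {l} → All (1 ≤_) l → h l ≡ 2 →
  (∃[ p ] ∃[ q ] l ≡ w p ((3 , q) ∷ [])) ⊎ (∃[ p ] ∃[ b ] ∃[ q ] l ≡ w p ((2 , b) ∷ (2 , q) ∷ []))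
h≡2⇒w {suc zero ∷ xs} (s≤s z≤n ∷ ps) e with h≡2⇒w ps (trans (sym (h-∷ 0 ps)) e)
... | inj₁ (p , q , refl)     = inj₁ (suc p , q , refl)
... | inj₂ (p , b , q , refl) = inj₂ (suc p , b , q , refl)
h≡2⇒w {suc (suc zero) ∷ xs} (s≤s z≤n ∷ ps) e with h≡1⇒w ps (suc-injective (trans (sym (h-∷ 1 ps)) e))
... | b , q , refl = inj₂ (0 , b , q , refl)
h≡2⇒w {suc (suc (suc zero)) ∷ xs} (s≤s z≤n ∷ ps) e =
  inj₁ (0 , length xs , cong (3 ∷_) (h≡0⇒ones ps (suc-injective (suc-injective (trans (sym (h-∷ 2 ps)) e)))))
h≡2⇒w {suc (suc (suc (suc y))) ∷ xs} (s≤s z≤n ∷ ps) e with () ← trans (sym (h-∷ (suc (suc (suc y))) ps)) e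

∸-from-+ : ∀ {m k r} → m + k ≡ r → m ≡ r ∸ k
∸-from-+ {m} {k} refl = sym (m+n∸n≡m m k)

Ea0⇒ones : ∀ {r l} → Ea r 0 l → l ≡ ones (suc r)
Ea0⇒ones {r} {l} ((ps , _ , _ , sm) , e) = trans l≡ones (cong ones length≡)
  where
  l≡ones = h≡0⇒ones ps e
  length≡ : length l ≡ suc r
  length≡ = trans (sym (sum-ones (length l))) (trans (cong sum (sym l≡ones)) sm)

Ea1⇒W₁ : ∀ {r l} → Ea (suc r) 1 l → W₁ 2 r l
Ea1⇒W₁ {r} ((ps , hd , ls , sm) , e) with h≡1⇒w ps e
... | p , q , refl = bordered p q hd (trans (sym (last-++ (ones p) 2 (ones q))) ls) sm
  where
  bordered : ∀ p q → head (w p ((2 , q) ∷ [])) ≡ just 1 → last (2 ∷ ones q) ≡ just 1 →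
             sum (w p ((2 , q) ∷ [])) ≡ 2 + r → W₁ 2 r (w p ((2 , q) ∷ []))
  bordered zero    _       () _  _
  bordered (suc a) zero    _  () _
  bordered (suc a) (suc c) _  _  s =
    suc a , suc c , s≤s z≤n , s≤s z≤n , suc-injective (suc-injective (trans (sym (sum-w₁-2 (suc a) (suc c))) s)) , refl

W₁⇒Ea1 : ∀ {r l} → W₁ 2 r l → Ea (suc r) 1 l
W₁⇒Ea1 (suc a , suc c , s≤s z≤n , s≤s z≤n , eq , refl) =
  ( ++⁺ (All-ones (suc a)) (s≤s z≤n ∷ All-ones (suc c))
  , refl
  , trans (last-++ (ones (suc a)) 2 (ones (suc c))) (last-ones c)
  , trans (sum-w₁-2 (suc a) (suc c)) (cong (_+_ 2) eq) )
  , h-w₁ (suc a) 1 (suc c)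

Ea2⇒U⊎V : ∀ {r l} → Ea r 2 l → U r l ⊎ V r l
Ea2⇒U⊎V {r} ((ps , hd , ls , sm) , e) with h≡2⇒w ps e
... | inj₁ (p , q , refl) = inj₁ (bordered p q hd (trans (sym (last-++ (ones p) 3 (ones q))) ls) sm)
  where
  bordered : ∀ p q → head (w p ((3 , q) ∷ [])) ≡ just 1 → last (3 ∷ ones q) ≡ just 1 →
             sum (w p ((3 , q) ∷ [])) ≡ suc r → U r (w p ((3 , q) ∷ []))
  bordered zero    _       () _  _
  bordered (suc a) zero    _  () _
  bordered (suc a) (suc c) _  _  s =
    suc a , suc c , s≤s z≤n , s≤s z≤n ,
    ∸-from-+ (suc-injective (trans (sym (regroup (suc a) (suc c))) (trans (sym (sum-w₁ (suc a) 3 (suc c))) s))) , refl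
    where
    regroup : ∀ p q → p + (3 + q) ≡ suc (p + q + 2)
    regroup = solve-∀
... | inj₂ (p , b , q , refl) =
  inj₂ (bordered p q hd (trans (sym (trans (last-++ (ones p) 2 _) (last-++ (2 ∷ ones b) 2 (ones q)))) ls) sm)
  where
  bordered : ∀ p q → head (w p ((2 , b) ∷ (2 , q) ∷ [])) ≡ just 1 → last (2 ∷ ones q) ≡ just 1 →
             sum (w p ((2 , b) ∷ (2 , q) ∷ [])) ≡ suc r → V r (w p ((2 , b) ∷ (2 , q) ∷ []))
  bordered zero    _       () _  _
  bordered (suc a) zero    _  () _
  bordered (suc a) (suc c) _  _  s =
    suc a , b , suc c , s≤s z≤n , s≤s z≤n ,
    ∸-from-+ (suc-injective (trans (sym (regroup (suc a) b (suc c))) (trans (sym (sum-w₂ (suc a) 2 b 2 (suc c))) s))) , refl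
    where
    regroup : ∀ p b q → p + (2 + (b + (2 + q))) ≡ suc (p + b + q + 3)
    regroup = solve-∀

-- The corollary for r = 6 + t

pos-minus : ∀ {m n k} → m + n ≡ k → + m ≡ + k ℤ.- + n
pos-minus {m} {n} refl = sym (begin
  + (m + n) ℤ.- + n ≡⟨ m-n≡m⊖n (m + n) n ⟩
  (m + n) ⊖ n       ≡⟨ ⊖-≥ (m≤n+m n m) ⟩
  + (m + n ∸ n)     ≡⟨ cong +_ (m+n∸n≡m m n) ⟩
  + m               ∎)
  where open ≡-Reasoning

F-6+-7 : ∀ t → F (+ (6 + t) ℤ.- + 7) ≡ + fib⁻ t
F-6+-7 zero    = refl
F-6+-7 (suc t) = refl

κ-ones : ∀ r → + κ (r + 1) [] ≡ F (+ (r + 2))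
κ-ones r = cong +_ (trans (K-ones (r + 1)) (cong fibℕ (sym (+-suc r 1))))

Ea1-≥ : ∀ t {m} → Ea (6 + t) 1 m → fibℕ (7 + t) + fibℕ (5 + t) ≤ K m
Ea1-≥ t em = ≤-trans (≤-reflexive (cong (_+_ (fibℕ (7 + t))) (sym (*-identityˡ (fibℕ (5 + t))))))
                     (W₁-≥ 1 (3 + t) (Ea1⇒W₁ em))

Ea1-max : ∀ t → ∃[ M ] (IsMax (Ea (6 + t) 1) K M × + M ℤ.< F (+ (6 + t + 2)))
Ea1-max t = M
          , ((w 2 ((2 , 3 + t) ∷ []) , W₁⇒Ea1 (2 , 3 + t , s≤s z≤n , s≤s z≤n , refl , refl) , attained) , λ _ → bound)
          , ℤ.+<+ (subst (M <_) (cong fibℕ (+-comm 2 (6 + t))) M<fib)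
  where
  x = fibℕ (4 + t)
  M = fibℕ (7 + t) + 2 * x
  attained : K (w 2 ((2 , 3 + t) ∷ [])) ≡ M
  attained = trans (K-w₁ 2 1 (3 + t)) (cong (_+_ (fibℕ (7 + t))) (*-identityˡ (2 * x)))
  bound : ∀ {m} → Ea (6 + t) 1 m → K m ≤ M
  bound em = ≤-trans (W₁-≤ 1 (3 + t) (Ea1⇒W₁ em)) (≤-reflexive (cong (_+_ (fibℕ (7 + t))) (*-identityˡ (2 * x))))
  M<fib : M < fibℕ (8 + t)
  M<fib = +-monoʳ-< (fibℕ (7 + t))
    (subst (λ v → suc v ≤ fibℕ (6 + t)) (cong (_+_ x) (sym (+-identityʳ x))) (+-monoˡ-< x (fib-strict (2 + t))))

Ea1-min-value : ∀ t → κ 1 ((2 , 4 + t) ∷ []) ≡ fibℕ (7 + t) + fibℕ (5 + t)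
Ea1-min-value t = trans (K-w₁ 1 1 (4 + t))
                        (cong (_+_ (fibℕ (7 + t))) (trans (*-identityˡ _) (*-identityˡ (fibℕ (5 + t)))))

Ea1-min : ∀ t → IsMin (Ea (6 + t) 1) K (κ 1 ((2 , 4 + t) ∷ []))
Ea1-min t = (_ , W₁⇒Ea1 (1 , 4 + t , s≤s z≤n , s≤s z≤n , refl , refl) , refl)
          , λ _ em → ≤-trans (≤-reflexive (Ea1-min-value t)) (Ea1-≥ t em)

Ea1-min-ℤ : ∀ t → + κ 1 ((2 , 4 + t) ∷ []) ≡ F (+ (6 + t + 1)) ℤ.+ F (+ (6 + t) ℤ.- + 1)
Ea1-min-ℤ t = cong +_ (trans (Ea1-min-value t) (cong (λ i → fibℕ i + fibℕ (5 + t)) (+-comm 1 (6 + t))))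

U-max : ∀ t → IsMax (U (6 + t)) K (κ 2 ((3 , 2 + t) ∷ []))
U-max t = (_ , (2 , 2 + t , s≤s z≤n , s≤s z≤n , refl , refl) , refl)
        , λ _ ul → ≤-trans (W₁-≤ 2 (2 + t) ul) (≤-reflexive (sym (K-w₁ 2 2 (2 + t))))

U-gap : ∀ t → κ 2 ((3 , 2 + t) ∷ []) + 2 * fibℕ (2 + t) ≡ fibℕ (7 + t) + fibℕ (5 + t)
U-gap t = trans (cong (_+ 2 * fibℕ (2 + t)) (K-w₁ 2 2 (2 + t))) (regroup (fibℕ (6 + t)) (fibℕ (3 + t)) (fibℕ (2 + t)))
  where
  regroup : ∀ x y z → x + 2 * (2 * y) + 2 * z ≡ (x + ((y + z) + y)) + ((y + z) + y)
  regroup = solve-∀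

U-max-ℤ : ∀ t → + κ 2 ((3 , 2 + t) ∷ [])
               ≡ F (+ (6 + t + 1)) ℤ.+ F (+ (6 + t) ℤ.- + 1) ℤ.- + 2 ℤ.* F (+ (6 + t) ℤ.- + 4)
U-max-ℤ t = trans (pos-minus (U-gap t))
                  (cong₂ (λ i k → + (fibℕ i + fibℕ (5 + t)) ℤ.- k) (+-comm 1 (6 + t)) (pos-* 2 (fibℕ (2 + t))))

V-max-value : ∀ t → κ 2 ((2 , 0) ∷ (2 , 1 + t) ∷ []) ≡ fibℕ (7 + t) + 2 * (2 * fibℕ (2 + t))
V-max-value t = trans (sym (+-identityʳ _)) (K-w₂-2-0-2-vajda 1 t)

V-max : ∀ t → IsMax (V (6 + t)) K (κ 2 ((2 , 0) ∷ (2 , 1 + t) ∷ []))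
V-max t = (_ , (2 , 0 , 1 + t , s≤s z≤n , s≤s z≤n , refl , refl) , refl)
        , λ _ vl → ≤-trans (V-≤ (1 + t) vl) (≤-reflexive (sym (V-max-value t)))

V-gap : ∀ t → κ 2 ((2 , 0) ∷ (2 , 1 + t) ∷ []) + fib⁻ t ≡ fibℕ (7 + t) + fibℕ (5 + t)
V-gap t = trans (cong (_+ fib⁻ t) (V-max-value t))
                (trans (+-assoc (fibℕ (7 + t)) _ (fib⁻ t)) (cong (_+_ (fibℕ (7 + t))) (sym (fib-5+ t))))

V-max-ℤ : ∀ t → + κ 2 ((2 , 0) ∷ (2 , 1 + t) ∷ [])
               ≡ F (+ (6 + t + 1)) ℤ.+ F (+ (6 + t) ℤ.- + 1) ℤ.- F (+ (6 + t) ℤ.- + 7)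
V-max-ℤ t = trans (pos-minus (V-gap t))
                  (cong₂ (λ i k → + (fibℕ i + fibℕ (5 + t)) ℤ.- k) (+-comm 1 (6 + t)) (sym (F-6+-7 t)))

Ea0⊎Ea2-gap : ∀ t {l} → Ea (5 + t) 0 l ⊎ Ea (6 + t) 2 l →
              ∃[ d ] ((t ≢ 1 → 0 < d) × K l + d ≤ fibℕ (7 + t) + fibℕ (5 + t))
Ea0⊎Ea2-gap t (inj₁ el) with Ea0⇒ones el
... | refl = fibℕ (5 + t) , (λ _ → fib-pos (4 + t)) , ≤-reflexive (cong (_+ fibℕ (5 + t)) (K-ones (6 + t)))
Ea0⊎Ea2-gap t (inj₂ el) with Ea2⇒U⊎V el
... | inj₁ ul = 2 * fibℕ (2 + t) , (λ _ → ≤-trans (fib-pos (1 + t)) (m≤m+n _ _))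
              , ≤-trans (+-monoˡ-≤ (2 * fibℕ (2 + t)) (proj₂ (U-max t) _ ul)) (≤-reflexive (U-gap t))
... | inj₂ vl = fib⁻ t , fib⁻-pos
              , ≤-trans (+-monoˡ-≤ (fib⁻ t) (proj₂ (V-max t) _ vl)) (≤-reflexive (V-gap t))

below-Ea1 : ∀ t (l m : List ℕ) → Ea (5 + t) 0 l ⊎ Ea (6 + t) 2 l → Ea (6 + t) 1 m → K l ≤ K m
below-Ea1 t l m el em with Ea0⊎Ea2-gap t el
... | d , _ , le = ≤-trans (m≤m+n (K l) d) (≤-trans le (Ea1-≥ t em))

strictly-below-Ea1 : ∀ t → t ≢ 1 → ∀ (l m : List ℕ) → Ea (5 + t) 0 l ⊎ Ea (6 + t) 2 l → Ea (6 + t) 1 m → K l < K m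
strictly-below-Ea1 t t≢1 l m el em with Ea0⊎Ea2-gap t el
... | d , d>0 , le = <-≤-trans (m<m+n (K l) (d>0 t≢1)) (≤-trans le (Ea1-≥ t em))

corollary5p2 : (r : ℕ) → 6 ≤ r →
      (∃[ M ] (IsMax (Ea r 1) K M × + M ℤ.< F (+ (r + 2))))
    × + κ (r + 1) [] ≡ F (+ (r + 2))
    × IsMin (Ea r 1) K (κ 1 ((2 , r ∸ 2) ∷ []))
    × + κ 1 ((2 , r ∸ 2) ∷ []) ≡ F (+ (r + 1)) ℤ.+ F (+ r ℤ.- + 1)
    × IsMax (U r) K (κ 2 ((3 , r ∸ 4) ∷ []))
    × + κ 2 ((3 , r ∸ 4) ∷ []) ≡ F (+ (r + 1)) ℤ.+ F (+ r ℤ.- + 1) ℤ.- + 2 ℤ.* F (+ r ℤ.- + 4)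
    × IsMax (V r) K (κ 2 ((2 , 0) ∷ (2 , r ∸ 5) ∷ []))
    × + κ 2 ((2 , 0) ∷ (2 , r ∸ 5) ∷ []) ≡ F (+ (r + 1)) ℤ.+ F (+ r ℤ.- + 1) ℤ.- F (+ r ℤ.- + 7)
    × (∀ (l m : List ℕ) → (Ea (r ∸ 1) 0 l ⊎ Ea r 2 l) → Ea r 1 m → K l ≤ K m)
    × (r ≢ 7 → ∀ (l m : List ℕ) → (Ea (r ∸ 1) 0 l ⊎ Ea r 2 l) → Ea r 1 m → K l < K m)
corollary5p2 r 6≤r with m≤n⇒∃[o]m+o≡n 6≤r
... | t , refl =
    Ea1-max t , κ-ones (6 + t) , Ea1-min t , Ea1-min-ℤ t , U-max t , U-max-ℤ t , V-max t , V-max-ℤ t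
  , below-Ea1 t , λ r≢7 → strictly-below-Ea1 t (r≢7 ∘ cong (_+_ 6))
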